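{- There is $c_0$ such that for every integer $c\geq c_0$, every subset $U$ of vertices of the red-blue graph $G_c$ with $|U|=4c$ contains at least $4.1c^2$ (unordered) pairs of vertices that are not joined by a blue edge and at least $4.1c^2$ pairs of vertices that are not joined by a red edge.
   Context: A red-blue graph is a graph each of whose edges is colored red or blue. The red-blue graph $G_c$ has as vertices all binary sequences of length at least $1$ and at most $c$, except that sequences of length exactly $c$ must end with $0$. For vertices $a=a_1\dots a_k$ and $b=b_1\dots b_l$ with $k\leq l$: if $k=l$ they are not adjacent; if $k<l$ they are adjacent iff $a_i=b_i$ for all $i<k$, and then the edge is blue if $a_k=b_k$ and red if $a_k\neq b_k$. -}

module Defs where

open import Data.Nat using (ℕ; _≤_; _<ᵇ_)
open import Data.Bool using (Bool; true; false; if_then_else_; not)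
open import Data.Bool.Properties using () renaming (_≟_ to _≟ᵇ_)
open import Data.List using (List; []; _∷_; length; filter; _++_)
open import Data.Maybe using (Maybe; just; nothing)
open import Data.Product using (_×_; ∃)
open import Relation.Nullary using (¬_; Dec; does)
open import Relation.Binary.PropositionalEquality using (_≡_)

-- Vertices of G_c: binary sequences (lists of Bool, false = 0, true = 1)
-- of length between 1 and c; those of length exactly c end with 0.
IsVertex : ℕ → List Bool → Set
IsVertex c v =
  (1 ≤ length v) × (length v ≤ c) × (length v ≡ c → ∃ λ w → v ≡ w ++ (false ∷ []))

data Color : Set where
  red blue : Color

-- For a = a_1..a_k shorter than b: adjacent iff a_i = b_i for all i < k;
-- then the edge is blue if a_k = b_k, red otherwise.
orient : List Bool → List Bool → Maybe Color
orient [] _ = nothing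
orient (_ ∷ _) [] = nothing
orient (x ∷ []) (y ∷ _) = if does (x ≟ᵇ y) then just blue else just red
orient (x ∷ xs@(_ ∷ _)) (y ∷ ys) = if does (x ≟ᵇ y) then orient xs ys else nothing

edge : List Bool → List Bool → Maybe Color
edge a b =
  if length a <ᵇ length b then orient a b
  else if length b <ᵇ length a then orient b a
  else nothing

isJustColor : Color → Maybe Color → Bool
isJustColor red (just red) = true
isJustColor blue (just blue) = true
isJustColor _ _ = false

pairsNotJoinedBy : Color → List (List Bool) → ℕ
pairsNotJoinedBy col [] = 0
pairsNotJoinedBy col (u ∷ us) =
  length (filter (λ v → Data.Bool.T? (not (isJustColor col (edge u v)))) us)
  Data.Nat.+ pairsNotJoinedBy col us

module Submission where

-- Writing
-- N and J for the numbers of pairs of U not joined, resp. joined, by an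
-- edge of colour col, we have N + J = n(n-1)/2 for n = |U|, so it suffices
-- to bound J from above.  The only input from the graph is a local fact:
-- a sequence x has at most |x| neighbours of colour col among sequences
-- no longer than itself.  Indeed such a neighbour v of length k < |x|
-- agrees with x before position k, and its k-th bit is forced by col, so
-- v is one of |x| explicit candidates; distinct neighbours are therefore
-- counted by a pigeonhole argument.  Repeatedly removing a longest vertex
-- from a list of n ≥ c distinct sequences of length at most c gives
--   2J + c² + c ≤ 2cn,
-- since each removal costs at most c and the last c vertices span at most
-- c(c-1)/2 pairs.  For n = 4c this yields 2N ≥ 9c² - 3c ≥ 8.2c² once c ≥ 4.

open import Defs
open import Data.Nat using (ℕ; _≤_; _*_)
open import Data.Bool using (Bool)
open import Data.List using (List; length)
open import Data.List.Relation.Unary.All using (All)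
open import Data.List.Relation.Unary.Unique.Propositional using (Unique)
open import Data.Product using (_×_; ∃)
open import Relation.Binary.PropositionalEquality using (_≡_)

open import Data.Nat using (suc; _+_; _<ᵇ_; z≤n; s≤s)
open import Data.Nat.Properties
open import Data.Nat.Tactic.RingSolver using (solve-∀)
open import Algebra.Properties.CommutativeSemigroup +-commutativeSemigroup using (interchange; x∙yz≈y∙xz)
open import Data.Bool using (true; false; not; T; T?)
open import Data.Bool.Properties using (¬-not) renaming (_≟_ to _≟ᵇ_)
open import Data.List using ([]; _∷_; filter; _++_; map)
open import Data.List.Properties using (length-map)
open import Data.List.Relation.Unary.All using ([]; _∷_) renaming (lookup to All-lookup; map to All-map)
open import Data.List.Relation.Unary.AllPairs using ([]; _∷_)
open import Data.List.Relation.Unary.Any using (here; there)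
open import Data.List.Membership.Propositional using (_∈_)
open import Data.List.Membership.Propositional.Properties using (∈-∃++; ∈-map⁺; ∈-filter⁻; ∈-++⁺ʳ)
open import Data.List.Extrema.Nat using (argmax; argmax-sel; f[⊥]≤f[argmax]; f[xs]≤f[argmax])
import Data.List.Relation.Unary.Unique.Propositional.Properties as Unique
open import Data.Maybe using (Maybe; just; nothing)
open import Data.Product using (_,_; proj₁; proj₂; ∃₂)
open import Data.Sum using (inj₁; inj₂)
open import Data.Unit using (tt)
open import Data.Empty using (⊥-elim)
open import Relation.Nullary using (Dec; yes; no)
open import Relation.Binary.PropositionalEquality using (refl; sym; trans; cong; cong₂; subst; _≢_; module ≡-Reasoning)

indicator : Bool → ℕ
indicator true = 1
indicator false = 0

module _ {A : Set} where

  count : (A → Bool) → List A → ℕ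
  count p [] = 0
  count p (x ∷ xs) = indicator (p x) + count p xs

  count-complement : (p : A → Bool) (xs : List A) →
    length (filter (λ v → T? (not (p v))) xs) + count p xs ≡ length xs
  count-complement p [] = refl
  count-complement p (x ∷ xs) with p x
  ... | true = trans (+-suc _ _) (cong suc (count-complement p xs))
  ... | false = cong suc (count-complement p xs)

  count≡length-filter : (p : A → Bool) (xs : List A) →
    count p xs ≡ length (filter (λ v → T? (p v)) xs)
  count≡length-filter p [] = refl
  count≡length-filter p (x ∷ xs) with p x
  ... | true = cong suc (count≡length-filter p xs)
  ... | false = count≡length-filter p xs

  count-remove : (p : A → Bool) (xs : List A) (y : A) (ys : List A) →
    count p (xs ++ y ∷ ys) ≡ indicator (p y) + count p (xs ++ ys)
  count-remove p [] y ys = refl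
  count-remove p (x ∷ xs) y ys = begin
    indicator (p x) + count p (xs ++ y ∷ ys)
      ≡⟨ cong (indicator (p x) +_) (count-remove p xs y ys) ⟩
    indicator (p x) + (indicator (p y) + count p (xs ++ ys))
      ≡⟨ x∙yz≈y∙xz (indicator (p x)) (indicator (p y)) _ ⟩
    indicator (p y) + (indicator (p x) + count p (xs ++ ys)) ∎
    where open ≡-Reasoning

  length-remove : (xs : List A) (y : A) (ys : List A) →
    length (xs ++ y ∷ ys) ≡ suc (length (xs ++ ys))
  length-remove [] y ys = refl
  length-remove (x ∷ xs) y ys = cong suc (length-remove xs y ys)

  All-remove : {P : A → Set} (xs : List A) {y : A} {ys : List A} →
    All P (xs ++ y ∷ ys) → All P (xs ++ ys)
  All-remove [] (_ ∷ pys) = pys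
  All-remove (x ∷ xs) (px ∷ pxs) = px ∷ All-remove xs pxs

  Unique-remove : (xs : List A) {y : A} {ys : List A} →
    Unique (xs ++ y ∷ ys) → Unique (xs ++ ys)
  Unique-remove [] (_ ∷ u) = u
  Unique-remove (x ∷ xs) (x∉ ∷ u) = All-remove xs x∉ ∷ Unique-remove xs u

  ∈-remove : (xs : List A) {y v : A} {ys : List A} → v ∈ xs ++ y ∷ ys → v ≢ y → v ∈ xs ++ ys
  ∈-remove [] (here v≡y) v≢y = ⊥-elim (v≢y v≡y)
  ∈-remove [] (there v∈) v≢y = v∈
  ∈-remove (x ∷ xs) (here v≡x) v≢y = here v≡x
  ∈-remove (x ∷ xs) (there v∈) v≢y = there (∈-remove xs v∈ v≢y)

  unique-⊆-length : (M S : List A) → Unique M → (∀ {v} → v ∈ M → v ∈ S) →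
    length M ≤ length S
  unique-⊆-length [] S _ _ = z≤n
  unique-⊆-length (a ∷ M) S (a∉M ∷ uM) M⊆S with ∈-∃++ (M⊆S (here refl))
  ... | S₁ , S₂ , refl = subst (suc (length M) ≤_) (sym (length-remove S₁ a S₂))
         (s≤s (unique-⊆-length M (S₁ ++ S₂) uM M⊆S₁++S₂))
    where
    M⊆S₁++S₂ : ∀ {v} → v ∈ M → v ∈ S₁ ++ S₂
    M⊆S₁++S₂ v∈M = ∈-remove S₁ (M⊆S (there v∈M)) (λ v≡a → All-lookup a∉M v∈M (sym v≡a))

  argmax-∈ : (f : A → ℕ) (x : A) (L : List A) → argmax f x L ∈ x ∷ L
  argmax-∈ f x L with argmax-sel f x L
  ... | inj₁ eq = here eq
  ... | inj₂ m∈ = there m∈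

  splitAtMax : (f : A → ℕ) (L : List A) {n : ℕ} → length L ≡ suc n →
    ∃₂ λ xs ys → ∃ λ y → L ≡ xs ++ y ∷ ys × All (λ v → f v ≤ f y) L
  splitAtMax f (x ∷ L) _ with ∈-∃++ (argmax-∈ f x L)
  ... | xs , ys , split = xs , ys , argmax f x L , split
                        , f[⊥]≤f[argmax] {f = f} x L ∷ f[xs]≤f[argmax] {f = f} x L

joins : Color → List Bool → List Bool → Bool
joins col u v = isJustColor col (edge u v)

joinedPairs : Color → List (List Bool) → ℕ
joinedPairs col [] = 0
joinedPairs col (u ∷ us) = count (joins col u) us + joinedPairs col us

pairCount-step : ∀ a b N J {k} → a + b ≡ k → 2 * (N + J) + k ≡ k * k →
  2 * ((a + N) + (b + J)) + suc k ≡ suc k * suc k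
pairCount-step a b N J refl total = begin
  2 * ((a + N) + (b + J)) + suc (a + b)          ≡⟨ regroup a b N J ⟩
  (2 * (N + J) + (a + b)) + 2 * (a + b) + 1      ≡⟨ cong (λ s → s + 2 * (a + b) + 1) total ⟩
  (a + b) * (a + b) + 2 * (a + b) + 1            ≡⟨ square-suc (a + b) ⟩
  suc (a + b) * suc (a + b)                      ∎
  where
  open ≡-Reasoning
  regroup : ∀ a b N J → 2 * ((a + N) + (b + J)) + suc (a + b)
                        ≡ (2 * (N + J) + (a + b)) + 2 * (a + b) + 1
  regroup = solve-∀
  square-suc : ∀ k → k * k + 2 * k + 1 ≡ suc k * suc k
  square-suc = solve-∀

-- Doubled form of  #non-joined + #joined = n(n-1)/2.
pairs-split : (col : Color) (L : List (List Bool)) →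
  2 * (pairsNotJoinedBy col L + joinedPairs col L) + length L ≡ length L * length L
pairs-split col [] = refl
pairs-split col (u ∷ us) =
  pairCount-step (length (filter (λ v → T? (not (joins col u v))) us)) (count (joins col u) us)
                 (pairsNotJoinedBy col us) (joinedPairs col us)
                 (count-complement (joins col u) us) (pairs-split col us)

edge-sym : (u v : List Bool) → edge u v ≡ edge v u
edge-sym u v with length u <ᵇ length v in u<v | length v <ᵇ length u in v<u
... | true | true = ⊥-elim (<-asym (<ᵇ⇒< (length u) (length v) (subst T (sym u<v) tt))
                                       (<ᵇ⇒< (length v) (length u) (subst T (sym v<u) tt)))
... | true | false = refl
... | false | true = refl
... | false | false = refl

joinedPairs-remove : (col : Color) (xs : List (List Bool)) (y : List Bool) (ys : List (List Bool)) →
  joinedPairs col (xs ++ y ∷ ys) ≡ count (joins col y) (xs ++ ys) + joinedPairs col (xs ++ ys)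
joinedPairs-remove col [] y ys = refl
joinedPairs-remove col (x ∷ xs) y ys = begin
  count (joins col x) (xs ++ y ∷ ys) + joinedPairs col (xs ++ y ∷ ys)
    ≡⟨ cong₂ _+_ (count-remove (joins col x) xs y ys) (joinedPairs-remove col xs y ys) ⟩
  (indicator (joins col x y) + cx) + (cy + J)
    ≡⟨ cong (λ e → (indicator e + cx) + (cy + J)) (cong (isJustColor col) (edge-sym x y)) ⟩
  (e + cx) + (cy + J)
    ≡⟨ interchange e cx cy J ⟩
  (e + cy) + (cx + J) ∎
  where
  open ≡-Reasoning
  e : ℕ
  e = indicator (joins col y x)
  cx : ℕ
  cx = count (joins col x) (xs ++ ys)
  cy : ℕ
  cy = count (joins col y) (xs ++ ys)
  J : ℕ
  J = joinedPairs col (xs ++ ys)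

-- The candidates for a shorter col-neighbour of x: for each k ≤ |x|, the
-- first k-1 bits of x followed by the k-th bit of x (blue) or its negation (red).
kthBit : Color → Bool → Bool
kthBit blue b = b
kthBit red b = not b

candidates : Color → List Bool → List (List Bool)
candidates col [] = []
candidates col (b ∷ bs) = (kthBit col b ∷ []) ∷ map (b ∷_) (candidates col bs)

length-candidates : (col : Color) (x : List Bool) → length (candidates col x) ≡ length x
length-candidates col [] = refl
length-candidates col (b ∷ bs) =
  cong suc (trans (length-map (b ∷_) (candidates col bs)) (length-candidates col bs))

orient⇒candidate : (col : Color) (v x : List Bool) → orient v x ≡ just col → v ∈ candidates col x
orient⇒candidate col (a ∷ []) (b ∷ bs) eq with a ≟ᵇ b
orient⇒candidate blue (a ∷ []) (b ∷ bs) refl | yes refl = here refl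
orient⇒candidate red (a ∷ []) (b ∷ bs) refl | no a≢b = here (cong (_∷ []) (¬-not a≢b))
orient⇒candidate col (a ∷ a′ ∷ as) (b ∷ bs) eq with a ≟ᵇ b
... | yes refl = there (∈-map⁺ (a ∷_) (orient⇒candidate col (a′ ∷ as) bs eq))

isJustColor⇒≡ : (col : Color) (m : Maybe Color) → T (isJustColor col m) → m ≡ just col
isJustColor⇒≡ red (just red) _ = refl
isJustColor⇒≡ blue (just blue) _ = refl

joins⇒candidate : (col : Color) (x v : List Bool) → length v ≤ length x →
  T (joins col x v) → v ∈ candidates col x
joins⇒candidate col x v v≤x joined with length x <ᵇ length v in x<v
... | true = ⊥-elim (≤⇒≯ v≤x (<ᵇ⇒< (length x) (length v) (subst T (sym x<v) tt)))
... | false with length v <ᵇ length x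
...   | true = orient⇒candidate col v x (isJustColor⇒≡ col (orient v x) joined)
...   | false with () ← isJustColor⇒≡ col nothing joined

shorterNeighbours-bound : (col : Color) (x : List Bool) (M : List (List Bool)) → Unique M →
  All (λ v → length v ≤ length x) M → count (joins col x) M ≤ length x
shorterNeighbours-bound col x M uM shortM = begin
  count (joins col x) M       ≡⟨ count≡length-filter (joins col x) M ⟩
  length (filter P? M)        ≤⟨ unique-⊆-length (filter P? M) (candidates col x)
                                   (Unique.filter⁺ P? uM) neighbours⊆candidates ⟩
  length (candidates col x)   ≡⟨ length-candidates col x ⟩
  length x                    ∎
  where
  open ≤-Reasoning
  P? : (v : List Bool) → Dec (T (joins col x v))
  P? v = T? (joins col x v)
  neighbours⊆candidates : ∀ {v} → v ∈ filter P? M → v ∈ candidates col x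
  neighbours⊆candidates {v} v∈ with ∈-filter⁻ P? v∈
  ... | v∈M , joined = joins⇒candidate col x v (All-lookup shortM v∈M) joined

joinedPairs-bound : (col : Color) (c m : ℕ) (L : List (List Bool)) → Unique L →
  All (λ v → length v ≤ c) L → length L ≡ m + c →
  2 * joinedPairs col L + c * c + c ≤ (m + c) * (2 * c)
joinedPairs-bound col c 0 L uL shortL lenL = begin
  2 * J + c * c + c          ≡⟨ move-square (2 * J) (c * c) c ⟩
  (2 * J + c) + c * c        ≤⟨ +-monoˡ-≤ (c * c) (+-monoˡ-≤ c 2J≤) ⟩
  (2 * (N + J) + c) + c * c  ≡⟨ cong (_+ c * c) total ⟩
  c * c + c * c              ≡⟨ double-square c ⟩
  c * (2 * c)                ∎
  where
  open ≤-Reasoning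
  J : ℕ
  J = joinedPairs col L
  N : ℕ
  N = pairsNotJoinedBy col L
  2J≤ : 2 * J ≤ 2 * (N + J)
  2J≤ = *-monoʳ-≤ 2 (m≤n+m J N)
  total : 2 * (N + J) + c ≡ c * c
  total = subst (λ n → 2 * (N + J) + n ≡ n * n) lenL (pairs-split col L)
  move-square : ∀ a b c → a + b + c ≡ (a + c) + b
  move-square = solve-∀
  double-square : ∀ c → c * c + c * c ≡ c * (2 * c)
  double-square = solve-∀
joinedPairs-bound col c (suc m) L uL shortL lenL with splitAtMax length L lenL
... | xs , ys , y , refl , longest = begin
  2 * joinedPairs col (xs ++ y ∷ ys) + c * c + c
    ≡⟨ cong (λ j → 2 * j + c * c + c) (joinedPairs-remove col xs y ys) ⟩
  2 * (d + J) + c * c + c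
    ≡⟨ split-off d J c ⟩
  2 * d + (2 * J + c * c + c)
    ≤⟨ +-mono-≤ (*-monoʳ-≤ 2 d≤c) (joinedPairs-bound col c m (xs ++ ys) uL′ shortL′ lenL′) ⟩
  2 * c + (m + c) * (2 * c) ∎
  where
  open ≤-Reasoning
  d : ℕ
  d = count (joins col y) (xs ++ ys)
  J : ℕ
  J = joinedPairs col (xs ++ ys)
  uL′ : Unique (xs ++ ys)
  uL′ = Unique-remove xs uL
  shortL′ : All (λ v → length v ≤ c) (xs ++ ys)
  shortL′ = All-remove xs shortL
  lenL′ : length (xs ++ ys) ≡ m + c
  lenL′ = suc-injective (trans (sym (length-remove xs y ys)) lenL)
  d≤c : d ≤ c
  d≤c = ≤-trans (shorterNeighbours-bound col y (xs ++ ys) uL′ (All-remove xs longest))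
                (All-lookup shortL (∈-++⁺ʳ xs (here refl)))
  split-off : ∀ d J c → 2 * (d + J) + c * c + c ≡ 2 * d + (2 * J + c * c + c)
  split-off = solve-∀

-- Combining N + J = C(4c, 2) with the peeling bound for n = 4c
-- (both doubled) gives 2N ≥ 9c² - 3c.
nonJoined-lower : (c N J : ℕ) → 2 * (N + J) + 4 * c ≡ (4 * c) * (4 * c) →
  2 * J + c * c + c ≤ (3 * c + c) * (2 * c) → 9 * (c * c) ≤ 2 * N + 3 * c
nonJoined-lower c N J total joinedBound = +-cancelʳ-≤ (8 * (c * c) + c) _ _ (begin
  9 * (c * c) + (8 * (c * c) + c)                ≡⟨ expand-square c ⟩
  (4 * c) * (4 * c) + (c * c + c)                ≡⟨ cong (_+ (c * c + c)) (sym total) ⟩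
  (2 * (N + J) + 4 * c) + (c * c + c)            ≡⟨ isolate-J N J c ⟩
  (2 * N + 3 * c) + ((2 * J + c * c + c) + c)    ≤⟨ +-monoʳ-≤ (2 * N + 3 * c) (+-monoˡ-≤ c joinedBound) ⟩
  (2 * N + 3 * c) + ((3 * c + c) * (2 * c) + c)  ≡⟨ collapse N c ⟩
  (2 * N + 3 * c) + (8 * (c * c) + c)            ∎)
  where
  open ≤-Reasoning
  expand-square : ∀ c → 9 * (c * c) + (8 * (c * c) + c) ≡ (4 * c) * (4 * c) + (c * c + c)
  expand-square = solve-∀
  isolate-J : ∀ N J c → (2 * (N + J) + 4 * c) + (c * c + c) ≡ (2 * N + 3 * c) + ((2 * J + c * c + c) + c)
  isolate-J = solve-∀
  collapse : ∀ N c → (2 * N + 3 * c) + ((3 * c + c) * (2 * c) + c) ≡ (2 * N + 3 * c) + (8 * (c * c) + c)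
  collapse = solve-∀

-- For c ≥ 4 we have 30c ≤ 8c², so 2N ≥ 9c² - 3c implies 10N ≥ 41c².
nonJoined-arith : (c N : ℕ) → 4 ≤ c → 9 * (c * c) ≤ 2 * N + 3 * c → 41 * (c * c) ≤ 10 * N
nonJoined-arith c N 4≤c lower = *-cancelˡ-≤ 2 (+-cancelʳ-≤ (30 * c) _ _ (begin
  2 * (41 * (c * c)) + 30 * c     ≡⟨ expand-target c ⟩
  82 * (c * c) + 30 * c           ≤⟨ +-monoʳ-≤ (82 * (c * c)) 30c≤8c² ⟩
  82 * (c * c) + 8 * (c * c)      ≡⟨ sum-squares c ⟩
  10 * (9 * (c * c))              ≤⟨ *-monoʳ-≤ 10 lower ⟩
  10 * (2 * N + 3 * c)            ≡⟨ expand-bound N c ⟩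
  2 * (10 * N) + 30 * c           ∎))
  where
  open ≤-Reasoning
  30c≤8c² : 30 * c ≤ 8 * (c * c)
  30c≤8c² = begin
    30 * c       ≤⟨ *-monoˡ-≤ c (m≤n+m 30 2) ⟩
    32 * c       ≡⟨ *-assoc 8 4 c ⟩
    8 * (4 * c)  ≤⟨ *-monoʳ-≤ 8 (*-monoˡ-≤ c 4≤c) ⟩
    8 * (c * c)  ∎
  expand-target : ∀ c → 2 * (41 * (c * c)) + 30 * c ≡ 82 * (c * c) + 30 * c
  expand-target = solve-∀
  sum-squares : ∀ c → 82 * (c * c) + 8 * (c * c) ≡ 10 * (9 * (c * c))
  sum-squares = solve-∀
  expand-bound : ∀ N c → 10 * (2 * N + 3 * c) ≡ 2 * (10 * N) + 30 * c
  expand-bound = solve-∀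

manyNonJoinedPairs : (col : Color) (c : ℕ) → 4 ≤ c → (U : List (List Bool)) → Unique U →
  All (IsVertex c) U → length U ≡ 4 * c → 41 * (c * c) ≤ 10 * pairsNotJoinedBy col U
manyNonJoinedPairs col c 4≤c U uU vertices lenU =
  nonJoined-arith c N 4≤c (nonJoined-lower c N J total joinedBound)
  where
  N : ℕ
  N = pairsNotJoinedBy col U
  J : ℕ
  J = joinedPairs col U
  total : 2 * (N + J) + 4 * c ≡ (4 * c) * (4 * c)
  total = subst (λ n → 2 * (N + J) + n ≡ n * n) lenU (pairs-split col U)
  shortU : All (λ v → length v ≤ c) U
  shortU = All-map (λ isVertex → proj₁ (proj₂ isVertex)) vertices
  four-split : ∀ c → 4 * c ≡ 3 * c + c
  four-split = solve-∀
  joinedBound : 2 * J + c * c + c ≤ (3 * c + c) * (2 * c)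
  joinedBound = joinedPairs-bound col c (3 * c) U uU shortU (trans lenU (four-split c))

lemma1 : ∃ λ c₀ → ∀ (c : ℕ) → c₀ ≤ c →
           ∀ (U : List (List Bool)) → Unique U → All (IsVertex c) U → length U ≡ 4 * c →
           (41 * (c * c) ≤ 10 * pairsNotJoinedBy blue U)
           × (41 * (c * c) ≤ 10 * pairsNotJoinedBy red U)
lemma1 = 4 , λ c 4≤c U uU vertices lenU →
  manyNonJoinedPairs blue c 4≤c U uU vertices lenU , manyNonJoinedPairs red c 4≤c U uU vertices lenU
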